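{- Let $G=(V,E)$ be a strongly connected digraph, $s\in V$, and let $H$ be the auxiliary graph of the flow graph $G_s$. For every $w\in V$, there is no edge $(x,y)\in E(H)$ with $x\notin D(r_w)$ and $y\in D(r_w)$.
   Context: The flow graph $G_s$ is $G$ with start vertex $s$. A vertex $a$ dominates $b$ if every path from $s$ to $b$ contains $a$; the dominator tree $D$ is the rooted tree on $V$ (root $s$) in which $a$ is an ancestor of $b$ iff $a$ dominates $b$; $d(b)$ is the parent of $b$ in $D$ and $D(b)$ is the set of descendants of $b$ in $D$ (including $b$). An edge $(x,y)$ is a bridge of $G_s$ if every path from $s$ to $y$ contains $(x,y)$ (then $x=d(y)$, so bridges are edges of $D$). The bridge decomposition of $D$ is the forest obtained from $D$ by deleting all bridges of $G_s$; $r_w$ denotes the root of the tree of this forest that contains $w$. The auxiliary graph $H=(V,E')$ of $G_s$: start with $E'=E\setminus BR$, where $BR$ is the set of bridges of $G_s$; then for every bridge $(p,q)$ of $G_s$ and every edge $(x,y)\in E$ with $x\in D(q)$ and $y\notin D(q)$, add the edge $(p,y)$ to $E'$. -}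

module Defs where

open import Level using (Level; _⊔_) renaming (suc to lsuc)
open import Data.Fin using (Fin)
open import Data.Nat using (ℕ)
open import Data.Product using (Σ; Σ-syntax; _×_; _,_)
open import Data.Sum using (_⊎_)
open import Relation.Nullary using (¬_)
open import Relation.Binary.PropositionalEquality using (_≡_; _≢_)

-- A finite digraph on vertex set Fin n, given by its edge relation E.
-- (Simple digraph: an edge (x,y) is determined by its endpoints.)
Digraph : ℕ → Set₁
Digraph n = Fin n → Fin n → Set

module _ {n : ℕ} (E : Digraph n) where

  data Walk : Fin n → Fin n → Set where
    []  : ∀ {u} → Walk u u
    _∷_ : ∀ {u v w} → E u v → Walk v w → Walk u w

  data VIn (a : Fin n) : ∀ {u v} → Walk u v → Set where
    here  : ∀ {v} {p : Walk a v} → VIn a p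
    there : ∀ {u u' v} {e : E u u'} {p : Walk u' v} → VIn a p → VIn a (e ∷ p)

  data EIn (x y : Fin n) : ∀ {u v} → Walk u v → Set where
    here  : ∀ {v} {e : E x y} {p : Walk y v} → EIn x y (e ∷ p)
    there : ∀ {u u' v} {e : E u u'} {p : Walk u' v} → EIn x y p → EIn x y (e ∷ p)

  StronglyConnected : Set
  StronglyConnected = ∀ u v → Walk u v

  module FlowGraph (s : Fin n) where

    Dom : Fin n → Fin n → Set
    Dom a b = (p : Walk s b) → VIn a p

    -- D(b) = set of descendants of b in the dominator tree (including b),
    -- i.e. the vertices dominated by b
    InD : Fin n → Fin n → Set
    InD b v = Dom b v

    SDom : Fin n → Fin n → Set
    SDom a b = Dom a b × a ≢ b

    IsIdom : Fin n → Fin n → Set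
    IsIdom a b = SDom a b × (∀ c → SDom c b → Dom c a)

    Bridge : Fin n → Fin n → Set
    Bridge x y = E x y × ((p : Walk s y) → EIn x y p)

    -- u is the root of a tree of the bridge decomposition:
    -- u = s, or the tree edge (d(u),u) is a bridge
    TreeRoot : Fin n → Set
    TreeRoot u = u ≡ s ⊎ (Σ[ p ∈ Fin n ] (IsIdom p u × Bridge p u))

    -- r = r_w : the root of the tree of the bridge decomposition containing w,
    -- i.e. the nearest ancestor r of w in D (w itself allowed) such that the
    -- D-path from r down to w uses no bridge.
    IsRw : Fin n → Fin n → Set
    IsRw r w = Dom r w × TreeRoot r
             × (∀ v → SDom r v → Dom v w → ¬ (Σ[ p ∈ Fin n ] (IsIdom p v × Bridge p v)))

    HEdge : Fin n → Fin n → Set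
    HEdge x y = (E x y × ¬ Bridge x y)
              ⊎ (Σ[ q ∈ Fin n ] Σ[ x' ∈ Fin n ]
                   (Bridge x q × E x' y × InD q x' × ¬ InD q y))

module Submission where

open import Defs
open import Data.Nat using (ℕ)
open import Data.Fin using (Fin; _≟_)
open import Data.Empty using (⊥; ⊥-elim)
open import Data.Unit using (⊤; tt)
open import Data.Product using (Σ-syntax; _,_; proj₂)
open import Data.Sum using (_⊎_; inj₁; inj₂)
open import Relation.Nullary using (¬_; Dec; yes; no)
open import Relation.Nullary.Decidable using (decidable-stable)
open import Relation.Binary.PropositionalEquality using (_≢_; refl)

-- If r ≠ s then r is entered by a bridge
-- (p₀, r), and a path from s that avoids r and then steps into D(r) must step onto r
-- along that very bridge. Hence no non-bridge edge of G enters D(r). For an edge (x, y)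
-- of H coming from a bridge (x, q) and an edge (x′, y) with x′ ∈ D(q), a walk from q
-- to x′ that never returns to q cannot meet r (unless r ∈ D(q), which would put
-- y ∈ D(q)); so (x′, y) is the bridge into r = y, and again y ∈ D(q).

module Walks {n : ℕ} (E : Digraph n) where

  infixr 5 _++_

  _++_ : ∀ {u v w} → Walk E u v → Walk E v w → Walk E u w
  [] ++ q = q
  (e ∷ p) ++ q = e ∷ (p ++ q)

  VIn-++⁻ : ∀ {a u v w} (p : Walk E u v) {q : Walk E v w} →
            VIn E a (p ++ q) → VIn E a p ⊎ VIn E a q
  VIn-++⁻ []      a∈q       = inj₂ a∈q
  VIn-++⁻ (e ∷ p) here      = inj₁ here
  VIn-++⁻ (e ∷ p) (there a∈) with VIn-++⁻ p a∈
  ... | inj₁ a∈p = inj₁ (there a∈p)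
  ... | inj₂ a∈q = inj₂ a∈q

  EIn-++⁻ : ∀ {a b u v w} (p : Walk E u v) {q : Walk E v w} →
            EIn E a b (p ++ q) → EIn E a b p ⊎ EIn E a b q
  EIn-++⁻ []      ab∈q       = inj₂ ab∈q
  EIn-++⁻ (e ∷ p) here       = inj₁ here
  EIn-++⁻ (e ∷ p) (there ab∈) with EIn-++⁻ p ab∈
  ... | inj₁ ab∈p = inj₁ (there ab∈p)
  ... | inj₂ ab∈q = inj₂ ab∈q

  VIn-target : ∀ {u v} (p : Walk E u v) → VIn E v p
  VIn-target []      = here
  VIn-target (e ∷ p) = there (VIn-target p)

  EIn⇒VIn-source : ∀ {a b u v} {p : Walk E u v} → EIn E a b p → VIn E a p
  EIn⇒VIn-source here       = here
  EIn⇒VIn-source (there ab∈) = there (EIn⇒VIn-source ab∈)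

  EIn⇒VIn-target : ∀ {a b u v} {p : Walk E u v} → EIn E a b p → VIn E b p
  EIn⇒VIn-target here       = there here
  EIn⇒VIn-target (there ab∈) = there (EIn⇒VIn-target ab∈)

  VIn? : ∀ {u v} (a : Fin n) (p : Walk E u v) → Dec (VIn E a p)
  VIn? {u} a p with a ≟ u
  VIn? a p       | yes refl = yes here
  VIn? a []      | no a≢u   = no λ { here → a≢u refl }
  VIn? a (e ∷ p) | no a≢u with VIn? a p
  ... | yes a∈p = yes (there a∈p)
  ... | no  a∉p = no λ { here → a≢u refl ; (there a∈p) → a∉p a∈p }

  VIn-prefix : ∀ {a u v} {p : Walk E u v} → VIn E a p →
               Σ[ τ ∈ Walk E u a ] (∀ {b} → VIn E b τ → VIn E b p)
  VIn-prefix here = [] , λ { here → here }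
  VIn-prefix (there {e = e} a∈) with VIn-prefix a∈
  ... | τ , τ⊆p = e ∷ τ , λ { here → here ; (there b∈τ) → there (τ⊆p b∈τ) }

  VIn-suffix : ∀ {a u v} {p : Walk E u v} → VIn E a p →
               Σ[ τ ∈ Walk E a v ] (∀ {b} → VIn E b τ → VIn E b p)
  VIn-suffix {p = p} here = p , λ b∈ → b∈
  VIn-suffix (there a∈) with VIn-suffix a∈
  ... | τ , τ⊆p = τ , λ b∈τ → there (τ⊆p b∈τ)

  NoReturn : (q : Fin n) {v : Fin n} → Walk E q v → Set
  NoReturn q []      = ⊤
  NoReturn q (e ∷ σ) = ¬ VIn E q σ

  lastVisit : ∀ q {u v} (p : Walk E u v) → VIn E q p → Σ[ σ ∈ Walk E q v ] NoReturn q σ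
  lastVisit q []      here = [] , tt
  lastVisit q (e ∷ p) q∈ with VIn? q p
  ... | yes q∈p = lastVisit q p q∈p
  lastVisit q (e ∷ p) here       | no q∉p = e ∷ p , q∉p
  lastVisit q (e ∷ p) (there q∈p) | no q∉p = ⊥-elim (q∉p q∈p)

  NoReturn-suffix : ∀ {q a v} (σ : Walk E q v) → NoReturn q σ → VIn E a σ → a ≢ q →
                    Σ[ ρ ∈ Walk E a v ] ¬ VIn E q ρ
  NoReturn-suffix []      _   here        a≢q = ⊥-elim (a≢q refl)
  NoReturn-suffix (e ∷ σ) _   here        a≢q = ⊥-elim (a≢q refl)
  NoReturn-suffix (e ∷ σ) q∉σ (there a∈σ) _ with VIn-suffix a∈σ
  ... | ρ , ρ⊆σ = ρ , λ q∈ρ → q∉σ (ρ⊆σ q∈ρ)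

module Domination {n : ℕ} (E : Digraph n) (s : Fin n) where
  open Walks E
  open FlowGraph E s

  Dom-stable : ∀ {a b} → (∀ (p : Walk E s b) → ¬ ¬ VIn E a p) → Dom a b
  Dom-stable {a} h p = decidable-stable (VIn? a p) (h p)

  Dom-source : ∀ {b} → Dom s b
  Dom-source p = here

  Dom-trans : ∀ {a u v} → Dom a u → Dom u v → Dom a v
  Dom-trans a▹u u▹v t with VIn-prefix (u▹v t)
  ... | t′ , t′⊆t = t′⊆t (a▹u t′)

  Bridge⇒Dom : ∀ {u v} → Bridge u v → Dom u v
  Bridge⇒Dom (_ , uv∈) t = EIn⇒VIn-source (uv∈ t)

  Dom-noReturn-avoids : ∀ {q a v} → Dom q v → (τ : Walk E s a) → ¬ VIn E q τ →
                        (σ : Walk E q v) → NoReturn q σ → ¬ VIn E a σ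
  Dom-noReturn-avoids {q} {a} q▹v τ q∉τ σ noRet a∈σ with NoReturn-suffix σ noRet a∈σ a≢q
    where
    a≢q : a ≢ q
    a≢q refl = q∉τ (VIn-target τ)
  ... | ρ , q∉ρ with VIn-++⁻ τ (q▹v (τ ++ ρ))
  ...   | inj₁ q∈τ = q∉τ q∈τ
  ...   | inj₂ q∈ρ = q∉ρ q∈ρ

  avoiding-edge-into-Dom-is-bridge : ∀ {p₀ r x y} → Bridge p₀ r → Dom r y →
                                     (p : Walk E s x) → ¬ VIn E r p → E x y → Bridge x y
  avoiding-edge-into-Dom-is-bridge {r = r} bridge r▹y p r∉p e
    with VIn-++⁻ p (r▹y (p ++ e ∷ []))
  ... | inj₁ r∈p         = ⊥-elim (r∉p r∈p)
  ... | inj₂ here        = ⊥-elim (r∉p (VIn-target p))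
  ... | inj₂ (there here) with EIn-++⁻ p (proj₂ bridge (p ++ e ∷ []))
  ...   | inj₁ p₀r∈p = ⊥-elim (r∉p (EIn⇒VIn-target p₀r∈p))
  ...   | inj₂ here  = bridge

  no-HEdge-enters-TreeRoot : StronglyConnected E → ∀ {r x y} → TreeRoot r →
                             HEdge x y → ¬ InD r x → InD r y → ⊥
  no-HEdge-enters-TreeRoot sc (inj₁ refl) _ x∉Ds _ = x∉Ds Dom-source
  no-HEdge-enters-TreeRoot sc (inj₂ (_ , _ , bridge)) (inj₁ (e , ¬bridge)) x∉Dr y∈Dr =
    x∉Dr (Dom-stable λ p r∉p →
      ¬bridge (avoiding-edge-into-Dom-is-bridge bridge y∈Dr p r∉p e))
  no-HEdge-enters-TreeRoot sc {r} {x} {y} (inj₂ (_ , _ , bridge))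
                           (inj₂ (q , x′ , (xq , _) , e′ , x′∈Dq , y∉Dq)) x∉Dr y∈Dr =
    x∉Dr (Dom-stable λ p r∉p →
      y∉Dq (Dom-trans (Dom-stable λ τ q∉τ → y∉Dq (y∈Dq p r∉p τ q∉τ)) y∈Dr))
    where
    y∈Dq : (p : Walk E s x) → ¬ VIn E r p → (τ : Walk E s r) → ¬ VIn E q τ → InD q y
    y∈Dq p r∉p τ q∉τ with lastVisit q (sc q x′) here
    ... | σ , σ-noReturn =
      Dom-trans x′∈Dq (Bridge⇒Dom (avoiding-edge-into-Dom-is-bridge bridge y∈Dr (p ++ xq ∷ σ) r∉pqσ e′))
      where
      r∉pqσ : ¬ VIn E r (p ++ xq ∷ σ)
      r∉pqσ r∈ with VIn-++⁻ p r∈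
      ... | inj₁ r∈p         = r∉p r∈p
      ... | inj₂ here        = r∉p (VIn-target p)
      ... | inj₂ (there r∈σ) = Dom-noReturn-avoids x′∈Dq τ q∉τ σ σ-noReturn r∈σ

lemma15 : (n : ℕ) (E : Digraph n) → StronglyConnected E → (s : Fin n) →
    let open FlowGraph E s in
    (w r : Fin n) → IsRw r w →
    (x y : Fin n) → HEdge x y → ¬ InD r x → InD r y → ⊥
lemma15 n E sc s w r (_ , root , _) x y =
  Domination.no-HEdge-enters-TreeRoot E s sc root
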